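{- Every \textsc{flipping coins} position is a number; that is, its value as a combinatorial game is equal to a dyadic rational.
   Context: \textsc{Flipping coins}: a position is a finite string $d_1d_2\ldots d_n$ with each $d_i\in\{0,1\}$ (written left to right). Any $0$s after the last $1$ are deleted, so a position is either empty or ends in $1$. A Left move chooses indices $i<j$ with $d_i=d_j=1$ and changes both to $0$. A Right move chooses indices $k<\ell$ with $d_k=0$ and $d_\ell=1$, and changes $d_k$ to $1$ and $d_\ell$ to $0$. After any move, all $0$s following the last $1$ are deleted. The game is played under normal play (a player unable to move loses), and positions are regarded as short partizan combinatorial games. -}

module Defs where

open import Data.Bool using (Bool; true; false; _∧_; not; if_then_else_)
open import Data.Nat using (ℕ; zero; suc; _+_; _<_)
open import Data.Nat.DivMod using (_/_; _%_)
open import Data.Integer using (ℤ; +_; -[1+_])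
open import Data.Fin using (Fin)
open import Data.List using (List; []; _∷_; length; lookup; map; concatMap; upTo; filter; sum; zip)
open import Data.Product using (_×_; _,_; proj₁; proj₂)
open import Relation.Nullary using (¬_)
open import Data.Bool.Properties using (T?)
open import Data.Bool using (T)

data Game : Set where
  ⟨_∣_⟩ : {m n : ℕ} → (Fin m → Game) → (Fin n → Game) → Game

_≤G_ : Game → Game → Set
(⟨_∣_⟩ {m₁} {n₁} GL GR) ≤G (⟨_∣_⟩ {m₂} {n₂} HL HR) =
  ((i : Fin m₁) → ¬ ((⟨ HL ∣ HR ⟩) ≤G GL i)) ×
  ((j : Fin n₂) → ¬ (HR j ≤G ⟨ GL ∣ GR ⟩))

_≈G_ : Game → Game → Set
G ≈G H = (G ≤G H) × (H ≤G G)

noOpts : Fin 0 → Game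
noOpts ()

one : Game → Fin 1 → Game
one g _ = g

negG : Game → Game
negG ⟨ L ∣ R ⟩ = ⟨ (λ j → negG (R j)) ∣ (λ i → negG (L i)) ⟩

natG : ℕ → Game
natG zero = ⟨ noOpts ∣ noOpts ⟩
natG (suc n) = ⟨ one (natG n) ∣ noOpts ⟩

-- Canonical game of the dyadic rational n / 2^k  (n, k natural):
--   n / 2^0     = natG n
--   (2j) / 2^(k+1)   = j / 2^k
--   (2j+1) / 2^(k+1) = { j / 2^k | (j+1) / 2^k }
dyadicℕ : ℕ → ℕ → Game
dyadicℕ n zero = natG n
dyadicℕ n (suc k) with n % 2
... | zero  = dyadicℕ (n / 2) k
... | suc _ = ⟨ one (dyadicℕ (n / 2) k) ∣ one (dyadicℕ (suc (n / 2)) k) ⟩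

dyadic : ℤ → ℕ → Game
dyadic (+ n) k = dyadicℕ n k
dyadic -[1+ n ] k = negG (dyadicℕ (suc n) k)

Position : Set
Position = List Bool     -- d_1 d_2 ... d_n, true = 1, false = 0 (0-based indices)

trim : List Bool → List Bool
trim [] = []
trim (b ∷ bs) with trim bs
... | []     = if b then b ∷ [] else []
... | c ∷ cs = b ∷ c ∷ cs

-- a position is a string that is empty or ends in 1
IsPosition : List Bool → Set
IsPosition p = trim p ≡′ p
  where
  open import Relation.Binary.PropositionalEquality renaming (_≡_ to _≡′_)

get : List Bool → ℕ → Bool
get [] _ = false
get (b ∷ bs) zero = b
get (b ∷ bs) (suc i) = get bs i

set : List Bool → ℕ → Bool → List Bool
set [] _ _ = []
set (b ∷ bs) zero c = c ∷ bs
set (b ∷ bs) (suc i) c = b ∷ set bs i c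

pairs : ℕ → List (ℕ × ℕ)
pairs n = concatMap (λ j → map (λ i → (i , j)) (upTo j)) (upTo n)

leftMoves : Position → List Position
leftMoves p = map (λ ij → trim (set (set p (proj₁ ij) false) (proj₂ ij) false))
                  (filter (λ ij → T? (get p (proj₁ ij) ∧ get p (proj₂ ij))) (pairs (length p)))

rightMoves : Position → List Position
rightMoves p = map (λ kl → trim (set (set p (proj₁ kl) true) (proj₂ kl) false))
                   (filter (λ kl → T? (not (get p (proj₁ kl)) ∧ get p (proj₂ kl))) (pairs (length p)))

-- Weight: sum of (i+1) over the indices i with d_i = 1.  Every move
-- strictly decreases it, so it is a sufficient amount of fuel.
weight : Position → ℕ
weight p = go 1 p
  where
  go : ℕ → List Bool → ℕ
  go _ [] = 0
  go k (b ∷ bs) = (if b then k else 0) + go (suc k) bs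

gameFuel : ℕ → Position → Game
gameFuel zero p = ⟨ noOpts ∣ noOpts ⟩
gameFuel (suc f) p =
  ⟨ lookup (map (gameFuel f) (leftMoves p)) ∣ lookup (map (gameFuel f) (rightMoves p)) ⟩

game : Position → Game
game p = gameFuel (weight p) p

-- A number G = ⟨ L ∣ R ⟩ is dyadic by Conway's simplicity argument: by induction its largest
-- left option and its smallest right option are dyadic, and a dyadic strictly between them
-- whose own options lie outside that interval equals G.  Such a dyadic is found by bisection
-- once the bounds are nonnegative; nonpositive bounds are reduced to that case by negation,
-- and otherwise 0 works.
--
-- Every move lowers the weight Σ (i + 1) of a position, so by induction all options of a
-- flipping-coins position are numbers, and it remains to show that no Right option B is ≤ a
-- Left option A.  Say Left removes the coins i < j and Right moves coin l to the empty place
-- k < l.  If l ∈ {i, j}, then B reaches A by Left removing k and the other coin, so B ≰ A.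
-- Otherwise the two moves commute: some C is reached from A by Right and from B by Left, and
-- B ≤ A ≤ C would contradict C being a Left option of B.

module Submission where

open import Defs
open import Data.Bool using (Bool; true; false; if_then_else_; T; not; _∧_)
open import Data.Bool.Properties using (T?)
open import Data.Empty using (⊥; ⊥-elim)
open import Data.Fin as Fin using (Fin)
open import Data.Fin.Properties using (all?; ¬∀⟶∃¬)
open import Data.Integer as Int using (ℤ; -[1+_])
open import Data.List using (List; []; _∷_; length; map; upTo; lookup)
open import Data.List.Membership.Propositional using (_∈_; find; lose)
open import Data.List.Membership.Propositional.Properties
  using (∈-lookup; ∈-map⁺; ∈-map⁻; ∈-concatMap⁺; ∈-concatMap⁻; ∈-upTo⁺; ∈-upTo⁻; ∈-map∘filter⁺; ∈-map∘filter⁻)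
open import Data.List.Relation.Unary.Any using (index)
open import Data.List.Relation.Unary.Any.Properties using (lookup-index)
open import Data.Maybe as Maybe using (Maybe; just; nothing)
open import Data.Maybe.Relation.Unary.All using (All; just; nothing)
open import Data.Maybe.Relation.Binary.Pointwise using (Pointwise; just; nothing)
open import Data.Nat using (ℕ; zero; suc; _+_; _*_; _^_; _≤_; _<_; z≤n; s≤s; z<s; ⌊_/2⌋; ⌈_/2⌉; _≤?_; _≡ᵇ_; _≟_)
open import Data.Nat.DivMod using (m*n/n≡m; m*n%n≡0; [m+kn]%n≡m%n; +-distrib-/-∣ʳ)
open import Data.Nat.Divisibility using (divides)
open import Data.Nat.Tactic.RingSolver using (solve-∀)
open import Data.Nat.Properties
  using (≤-refl; ≤-trans; ≤-pred; ≤-<-trans; <-≤-trans; <-trans; <-cmp; <⇒≢; ≰⇒>; n≮0; m≤n⇒m<n∨m≡n;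
         +-comm; +-identityʳ; *-comm; *-assoc; *-identityʳ; *-monoˡ-≤;
         m<m+n; m≤m+n; +-monoʳ-<; +-cancelʳ-<; ≡ᵇ⇒≡; ≡⇒≡ᵇ; module ≤-Reasoning)
open import Data.Product using (∃; ∃₂; _×_; _,_; proj₁; proj₂)
open import Data.Sum using (_⊎_; inj₁; inj₂)
open import Data.Unit using (⊤; tt)
open import Function using (_∘_; flip)
open import Relation.Binary.Definitions using (Reflexive; Transitive; tri<; tri≈; tri>)
open import Relation.Binary.PropositionalEquality
  using (_≡_; _≢_; _≗_; refl; sym; trans; cong; subst; subst₂; _→-setoid_; module ≡-Reasoning)
import Relation.Binary.Reasoning.Setoid as SetoidReasoning
open import Relation.Nullary using (¬_; Dec; yes; no; ¬?)
open import Relation.Nullary.Decidable using (_×-dec_; decidable-stable)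

-- Conway's order on short games

LeftOption : Game → Game → Set
LeftOption ⟨ L ∣ R ⟩ w = ∃ λ i → L i ≡ w

RightOption : Game → Game → Set
RightOption ⟨ L ∣ R ⟩ z = ∃ λ j → R j ≡ z

≤G-intro : ∀ {x y} → (∀ {w} → LeftOption x w → ¬ (y ≤G w)) →
           (∀ {z} → RightOption y z → ¬ (z ≤G x)) → x ≤G y
≤G-intro {⟨ L ∣ R ⟩} {⟨ L′ ∣ R′ ⟩} f g = (λ i → f (i , refl)) , (λ j → g (j , refl))

≤G-elimˡ : ∀ {x y w} → x ≤G y → LeftOption x w → ¬ (y ≤G w)
≤G-elimˡ {⟨ L ∣ R ⟩} {⟨ L′ ∣ R′ ⟩} (x≤y , _) (i , refl) = x≤y i

≤G-elimʳ : ∀ {x y z} → x ≤G y → RightOption y z → ¬ (z ≤G x)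
≤G-elimʳ {⟨ L ∣ R ⟩} {⟨ L′ ∣ R′ ⟩} (_ , x≤y) (j , refl) = x≤y j

≤G-refl : ∀ {x} → x ≤G x
≤G-refl {⟨ L ∣ R ⟩} =
  (λ i L≤ → ≤G-elimˡ L≤ (i , refl) ≤G-refl) ,
  (λ j ≤R → ≤G-elimʳ ≤R (j , refl) ≤G-refl)

≤G-trans : ∀ {x y z} → x ≤G y → y ≤G z → x ≤G z
≤G-trans {⟨ L ∣ R ⟩} {⟨ L′ ∣ R′ ⟩} {⟨ L″ ∣ R″ ⟩} (p , q) (p′ , q′) =
  (λ i z≤ → p i (≤G-trans (p′ , q′) z≤)) ,
  (λ j ≤x → q′ j (≤G-trans ≤x (p , q)))

leftOption-≱ : ∀ {x w} → LeftOption x w → ¬ (x ≤G w)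
leftOption-≱ o x≤w = ≤G-elimˡ x≤w o ≤G-refl

rightOption-≰ : ∀ {x z} → RightOption x z → ¬ (z ≤G x)
rightOption-≰ o z≤x = ≤G-elimʳ z≤x o ≤G-refl

≈G-refl : ∀ {x} → x ≈G x
≈G-refl = ≤G-refl , ≤G-refl

≈G-sym : ∀ {x y} → x ≈G y → y ≈G x
≈G-sym (x≤y , y≤x) = y≤x , x≤y

≈G-trans : ∀ {x y z} → x ≈G y → y ≈G z → x ≈G z
≈G-trans (x≤y , y≤x) (y≤z , z≤y) = ≤G-trans x≤y y≤z , ≤G-trans z≤y y≤x

≈G-reflexive : ∀ {x y} → x ≡ y → x ≈G y
≈G-reflexive refl = ≈G-refl

≈LeftOption : Game → Game → Set
≈LeftOption y w = ∃ λ w′ → LeftOption y w′ × w ≈G w′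

≈RightOption : Game → Game → Set
≈RightOption y z = ∃ λ z′ → RightOption y z′ × z ≈G z′

_⊆ₒ_ : Game → Game → Set
x ⊆ₒ y = (∀ {w} → LeftOption x w → ≈LeftOption y w) × (∀ {z} → RightOption x z → ≈RightOption y z)

≈G-byOptions : ∀ {x y} → x ⊆ₒ y → y ⊆ₒ x → x ≈G y
≈G-byOptions {x} {y} (xL , xR) (yL , yR) = ≤-by xL yR , ≤-by yL xR
  where
  ≤-by : ∀ {x y} → (∀ {w} → LeftOption x w → ≈LeftOption y w) →
         (∀ {z} → RightOption y z → ≈RightOption x z) → x ≤G y
  ≤-by xL yR = ≤G-intro
    (λ o y≤w → let (_ , o′ , w≈w′) = xL o in leftOption-≱ o′ (≤G-trans y≤w (proj₁ w≈w′)))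
    (λ o z≤x → let (_ , o′ , z≈z′) = yR o in rightOption-≰ o′ (≤G-trans (proj₂ z≈z′) z≤x))

_≤G?_ : ∀ x y → Dec (x ≤G y)
⟨ L ∣ R ⟩ ≤G? ⟨ L′ ∣ R′ ⟩ =
  all? (λ i → ¬? (⟨ L′ ∣ R′ ⟩ ≤G? L i)) ×-dec all? (λ j → ¬? (R′ j ≤G? ⟨ L ∣ R ⟩))

≰G-witness : ∀ {x y} → ¬ (x ≤G y) →
             (∃ λ w → LeftOption x w × y ≤G w) ⊎ (∃ λ z → RightOption y z × z ≤G x)
≰G-witness {x@(⟨_∣_⟩ {m} L R)} {y@(⟨_∣_⟩ {n = n′} L′ R′)} x≰y
  with all? (λ i → ¬? (y ≤G? L i)) | all? (λ j → ¬? (R′ j ≤G? x))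
... | yes noL | yes noR = ⊥-elim (x≰y (noL , noR))
... | no someL | _ =
  let (i , ¬¬y≤L) = ¬∀⟶∃¬ m _ (λ i → ¬? (y ≤G? L i)) someL
  in inj₁ (L i , (i , refl) , decidable-stable (y ≤G? L i) ¬¬y≤L)
... | yes _ | no someR =
  let (j , ¬¬R≤x) = ¬∀⟶∃¬ n′ _ (λ j → ¬? (R′ j ≤G? x)) someR
  in inj₂ (R′ j , (j , refl) , decidable-stable (R′ j ≤G? x) ¬¬R≤x)

_<G_ : Game → Game → Set
x <G y = x ≤G y × ¬ (y ≤G x)

<G-≤G-trans : ∀ {x y z} → x <G y → y ≤G z → x <G z
<G-≤G-trans (x≤y , y≰x) y≤z = ≤G-trans x≤y y≤z , λ z≤x → y≰x (≤G-trans y≤z z≤x)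

≤G-<G-trans : ∀ {x y z} → x ≤G y → y <G z → x <G z
≤G-<G-trans x≤y (y≤z , z≰y) = ≤G-trans x≤y y≤z , λ z≤x → z≰y (≤G-trans z≤x x≤y)

mutual
  negG-antitone : ∀ {x y} → x ≤G y → negG y ≤G negG x
  negG-antitone {⟨ L ∣ R ⟩} {⟨ L′ ∣ R′ ⟩} (p , q) =
    (λ j h → q j (negG-reflects h)) , (λ i h → p i (negG-reflects h))

  negG-reflects : ∀ {x y} → negG y ≤G negG x → x ≤G y
  negG-reflects {⟨ L ∣ R ⟩} {⟨ L′ ∣ R′ ⟩} (p , q) =
    (λ i h → q i (negG-antitone h)) , (λ j h → p j (negG-antitone h))

negG-<G : ∀ {x y} → x <G y → negG y <G negG x
negG-<G (x≤y , y≰x) = negG-antitone x≤y , λ h → y≰x (negG-reflects h)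

negG-cong : ∀ {x y} → x ≈G y → negG x ≈G negG y
negG-cong (x≤y , y≤x) = negG-antitone y≤x , negG-antitone x≤y

negG-leftOption⁻ : ∀ {x w} → LeftOption (negG x) w → ∃ λ z → RightOption x z × w ≡ negG z
negG-leftOption⁻ {⟨ L ∣ R ⟩} (j , refl) = R j , (j , refl) , refl

negG-rightOption⁻ : ∀ {x z} → RightOption (negG x) z → ∃ λ w → LeftOption x w × z ≡ negG w
negG-rightOption⁻ {⟨ L ∣ R ⟩} (i , refl) = L i , (i , refl) , refl

negG-involutive : ∀ x → negG (negG x) ≈G x
negG-involutive ⟨ L ∣ R ⟩ =
  ≈G-byOptions ((λ { (i , refl) → L i , (i , refl) , negG-involutive (L i) }) ,
                (λ { (j , refl) → R j , (j , refl) , negG-involutive (R j) }))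
               ((λ { (i , refl) → _ , (i , refl) , ≈G-sym (negG-involutive (L i)) }) ,
                (λ { (j , refl) → _ , (j , refl) , ≈G-sym (negG-involutive (R j)) }))

negG-zero : negG (natG 0) ≈G natG 0
negG-zero = ≈G-byOptions ((λ ()) , (λ ())) ((λ ()) , (λ ()))

-- Numbers

IsNumber : Game → Set
IsNumber ⟨ L ∣ R ⟩ = (∀ i → IsNumber (L i)) × (∀ j → IsNumber (R j)) × (∀ i j → ¬ (R j ≤G L i))

isNumber-leftOption : ∀ {x w} → IsNumber x → LeftOption x w → IsNumber w
isNumber-leftOption {⟨ L ∣ R ⟩} (nL , _ , _) (i , refl) = nL i

isNumber-rightOption : ∀ {x z} → IsNumber x → RightOption x z → IsNumber z
isNumber-rightOption {⟨ L ∣ R ⟩} (_ , nR , _) (j , refl) = nR j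

isNumber-options-apart : ∀ {x w z} → IsNumber x → LeftOption x w → RightOption x z → ¬ (z ≤G w)
isNumber-options-apart {⟨ L ∣ R ⟩} (_ , _ , apart) (i , refl) (j , refl) = apart i j

isNumber-intro : ∀ {x} → (∀ {w} → LeftOption x w → IsNumber w) → (∀ {z} → RightOption x z → IsNumber z) →
                 (∀ {w z} → LeftOption x w → RightOption x z → ¬ (z ≤G w)) → IsNumber x
isNumber-intro {⟨ L ∣ R ⟩} nL nR apart =
  (λ i → nL (i , refl)) , (λ j → nR (j , refl)) , (λ i j → apart (i , refl) (j , refl))

leftOption-≤G : ∀ {x w} → IsNumber x → LeftOption x w → w ≤G x
leftOption-≤G {⟨ L ∣ R ⟩} nx (i , refl) = ≤G-intro
  (λ o x≤w′ → leftOption-≱ (i , refl) (≤G-trans x≤w′ (leftOption-≤G (isNumber-leftOption nx (i , refl)) o)))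
  (λ o z≤L → isNumber-options-apart nx (i , refl) o z≤L)

≤G-rightOption : ∀ {x z} → IsNumber x → RightOption x z → x ≤G z
≤G-rightOption {⟨ L ∣ R ⟩} nx (j , refl) = ≤G-intro
  (λ o R≤w → isNumber-options-apart nx o (j , refl) R≤w)
  (λ o z′≤x → rightOption-≰ (j , refl) (≤G-trans (≤G-rightOption (isNumber-rightOption nx (j , refl)) o) z′≤x))

leftOption-<G : ∀ {x w} → IsNumber x → LeftOption x w → w <G x
leftOption-<G nx o = leftOption-≤G nx o , leftOption-≱ o

<G-rightOption : ∀ {x z} → IsNumber x → RightOption x z → x <G z
<G-rightOption nx o = ≤G-rightOption nx o , rightOption-≰ o

≤G-total : ∀ {x y} → IsNumber x → IsNumber y → x ≤G y ⊎ y ≤G x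
≤G-total {x} {y} nx ny with x ≤G? y
... | yes x≤y = inj₁ x≤y
... | no x≰y with ≰G-witness x≰y
...   | inj₁ (_ , o , y≤w) = inj₂ (≤G-trans y≤w (leftOption-≤G nx o))
...   | inj₂ (_ , o , z≤x) = inj₂ (≤G-trans (≤G-rightOption ny o) z≤x)


-- Dyadic games

⟦_∣_⟧ : Game → Game → Game
⟦ l ∣ r ⟧ = ⟨ one l ∣ one r ⟩

dyadicℕ-even : ∀ t k → dyadicℕ (t * 2) (suc k) ≡ dyadicℕ t k
dyadicℕ-even t k rewrite m*n%n≡0 t 2 ⦃ _ ⦄ | m*n/n≡m t 2 ⦃ _ ⦄ = refl

dyadicℕ-odd : ∀ t k → dyadicℕ (suc (t * 2)) (suc k) ≡ ⟦ dyadicℕ t k ∣ dyadicℕ (suc t) k ⟧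
dyadicℕ-odd t k
  rewrite [m+kn]%n≡m%n 1 t 2 ⦃ _ ⦄
        | +-distrib-/-∣ʳ 1 {t * 2} {2} (divides t refl) | m*n/n≡m t 2 ⦃ _ ⦄ = refl

data Halving : ℕ → Set where
  even : ∀ t → Halving (t * 2)
  odd  : ∀ t → Halving (suc (t * 2))

halving : ∀ n → Halving n
halving zero = even 0
halving (suc n) with halving n
... | even t = odd t
... | odd t = even (suc t)

isNumber-natG : ∀ n → IsNumber (natG n)
isNumber-natG zero = (λ ()) , (λ ()) , λ ()
isNumber-natG (suc n) = (λ _ → isNumber-natG n) , (λ ()) , λ _ ()

isNumber-⟦∣⟧ : ∀ {l r} → IsNumber l → IsNumber r → l <G r → IsNumber ⟦ l ∣ r ⟧
isNumber-⟦∣⟧ nl nr l<r = (λ _ → nl) , (λ _ → nr) , λ _ _ → proj₂ l<r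

mutual
  isNumber-dyadicℕ : ∀ n k → IsNumber (dyadicℕ n k)
  isNumber-dyadicℕ n zero = isNumber-natG n
  isNumber-dyadicℕ n (suc k) with halving n
  ... | even t = subst IsNumber (sym (dyadicℕ-even t k)) (isNumber-dyadicℕ t k)
  ... | odd t = subst IsNumber (sym (dyadicℕ-odd t k)) (isNumber-midpoint t k)

  isNumber-midpoint : ∀ t k → IsNumber ⟦ dyadicℕ t k ∣ dyadicℕ (suc t) k ⟧
  isNumber-midpoint t k =
    isNumber-⟦∣⟧ (isNumber-dyadicℕ t k) (isNumber-dyadicℕ (suc t) k) (dyadicℕ-<G-suc t k)

  dyadicℕ-<G-suc : ∀ n k → dyadicℕ n k <G dyadicℕ (suc n) k
  dyadicℕ-<G-suc n zero = leftOption-<G (isNumber-natG (suc n)) (Fin.zero , refl)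
  dyadicℕ-<G-suc n (suc k) with halving n
  ... | even t = subst₂ _<G_ (sym (dyadicℕ-even t k)) (sym (dyadicℕ-odd t k))
                   (leftOption-<G (isNumber-midpoint t k) (Fin.zero , refl))
  ... | odd t = subst₂ _<G_ (sym (dyadicℕ-odd t k)) (sym (dyadicℕ-even (suc t) k))
                   (<G-rightOption (isNumber-midpoint t k) (Fin.zero , refl))

dyadicℕ-<G : ∀ k {a b} → a < b → dyadicℕ a k <G dyadicℕ b k
dyadicℕ-<G k {a} (s≤s {n = b} a≤b) with m≤n⇒m<n∨m≡n a≤b
... | inj₁ a<b = <G-≤G-trans (dyadicℕ-<G k a<b) (proj₁ (dyadicℕ-<G-suc b k))
... | inj₂ refl = dyadicℕ-<G-suc a k

dyadicℕ-≤G : ∀ k {a b} → a ≤ b → dyadicℕ a k ≤G dyadicℕ b k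
dyadicℕ-≤G k a≤b with m≤n⇒m<n∨m≡n a≤b
... | inj₁ a<b = proj₁ (dyadicℕ-<G k a<b)
... | inj₂ refl = ≤G-refl

dyadicℕ-≰G⇒> : ∀ k {a b} → ¬ (dyadicℕ a k ≤G dyadicℕ b k) → b < a
dyadicℕ-≰G⇒> k {a} {b} a≰b = ≰⇒> (λ a≤b → a≰b (dyadicℕ-≤G k a≤b))

*2^suc : ∀ n j → n * 2 ^ suc j ≡ n * 2 ^ j * 2
*2^suc n j = trans (cong (n *_) (*-comm 2 (2 ^ j))) (sym (*-assoc n (2 ^ j) 2))

dyadicℕ-scale : ∀ n j k → dyadicℕ n k ≡ dyadicℕ (n * 2 ^ j) (j + k)
dyadicℕ-scale n zero k = cong (λ m → dyadicℕ m k) (sym (*-identityʳ n))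
dyadicℕ-scale n (suc j) k = begin
  dyadicℕ n k                          ≡⟨ dyadicℕ-scale n j k ⟩
  dyadicℕ (n * 2 ^ j) (j + k)          ≡⟨ sym (dyadicℕ-even (n * 2 ^ j) (j + k)) ⟩
  dyadicℕ (n * 2 ^ j * 2) (suc j + k)  ≡⟨ cong (λ m → dyadicℕ m (suc j + k)) (sym (*2^suc n j)) ⟩
  dyadicℕ (n * 2 ^ suc j) (suc j + k)  ∎
  where open ≡-Reasoning

⌊n/2⌋*2≤n : ∀ n → ⌊ n /2⌋ * 2 ≤ n
⌊n/2⌋*2≤n zero = z≤n
⌊n/2⌋*2≤n (suc zero) = z≤n
⌊n/2⌋*2≤n (suc (suc n)) = s≤s (s≤s (⌊n/2⌋*2≤n n))

n≤1+⌊n/2⌋*2 : ∀ n → n ≤ suc (⌊ n /2⌋ * 2)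
n≤1+⌊n/2⌋*2 zero = z≤n
n≤1+⌊n/2⌋*2 (suc zero) = s≤s z≤n
n≤1+⌊n/2⌋*2 (suc (suc n)) = s≤s (s≤s (n≤1+⌊n/2⌋*2 n))

n≤⌈n/2⌉*2 : ∀ n → n ≤ ⌈ n /2⌉ * 2
n≤⌈n/2⌉*2 n = ≤-pred (n≤1+⌊n/2⌋*2 (suc n))

dyadicℕ-⌊/2⌋-≤G : ∀ a K → dyadicℕ ⌊ a /2⌋ K ≤G dyadicℕ a (suc K)
dyadicℕ-⌊/2⌋-≤G a K =
  subst (_≤G dyadicℕ a (suc K)) (dyadicℕ-even ⌊ a /2⌋ K) (dyadicℕ-≤G (suc K) (⌊n/2⌋*2≤n a))

dyadicℕ-⌈/2⌉-≥G : ∀ b K → dyadicℕ b (suc K) ≤G dyadicℕ ⌈ b /2⌉ K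
dyadicℕ-⌈/2⌉-≥G b K =
  subst (dyadicℕ b (suc K) ≤G_) (dyadicℕ-even ⌈ b /2⌉ K) (dyadicℕ-≤G (suc K) (n≤⌈n/2⌉*2 b))

record DyadicBetween (K a b : ℕ) : Set where
  field
    n : ℕ
    a<n : a < n
    n<b : n < b
    leftOptions-≤G : ∀ {w} → LeftOption (dyadicℕ n K) w → w ≤G dyadicℕ a K
    rightOptions-≥G : ∀ {z} → RightOption (dyadicℕ n K) z → dyadicℕ b K ≤G z

dyadicBetween-midpoint : ∀ K {a b} → 2 + a ≤ b → ⌈ b /2⌉ ≤ suc ⌊ a /2⌋ → DyadicBetween (suc K) a b
dyadicBetween-midpoint K {a} {b} a+2≤b t≤s+1 = record
  { n = suc (s * 2)
  ; a<n = s≤s (≤-pred (≤-pred (≤-trans a+2≤b b≤s*2+2)))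
  ; n<b = ≤-trans (s≤s (s≤s (⌊n/2⌋*2≤n a))) a+2≤b
  ; leftOptions-≤G = λ o → left (subst (λ g → LeftOption g _) (dyadicℕ-odd s K) o)
  ; rightOptions-≥G = λ o → right (subst (λ g → RightOption g _) (dyadicℕ-odd s K) o)
  }
  where
  s = ⌊ a /2⌋
  b≤s*2+2 : b ≤ suc s * 2
  b≤s*2+2 = ≤-trans (n≤⌈n/2⌉*2 b) (*-monoˡ-≤ 2 t≤s+1)
  left : ∀ {w} → LeftOption ⟦ dyadicℕ s K ∣ dyadicℕ (suc s) K ⟧ w → w ≤G dyadicℕ a (suc K)
  left (_ , refl) = dyadicℕ-⌊/2⌋-≤G a K
  right : ∀ {z} → RightOption ⟦ dyadicℕ s K ∣ dyadicℕ (suc s) K ⟧ z → dyadicℕ b (suc K) ≤G z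
  right (_ , refl) = subst (dyadicℕ b (suc K) ≤G_) (dyadicℕ-even (suc s) K) (dyadicℕ-≤G (suc K) b≤s*2+2)

dyadicBetween-refine : ∀ K {a b} → DyadicBetween K ⌊ a /2⌋ ⌈ b /2⌉ → DyadicBetween (suc K) a b
dyadicBetween-refine K {a} {b} between = record
  { n = n * 2
  ; a<n = ≤-<-trans (n≤1+⌊n/2⌋*2 a) (*-monoˡ-≤ 2 a<n)
  ; n<b = ≤-pred (≤-trans (*-monoˡ-≤ 2 n<b) (⌊n/2⌋*2≤n (suc b)))
  ; leftOptions-≤G = λ o → ≤G-trans (leftOptions-≤G (subst (λ g → LeftOption g _) (dyadicℕ-even n K) o))
                                    (dyadicℕ-⌊/2⌋-≤G a K)
  ; rightOptions-≥G = λ o → ≤G-trans (dyadicℕ-⌈/2⌉-≥G b K)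
                                     (rightOptions-≥G (subst (λ g → RightOption g _) (dyadicℕ-even n K) o))
  }
  where open DyadicBetween between

-- Halve the endpoints; if they are no longer two apart, the midpoint (2⌊a/2⌋+1)/2^(K+1) works.
dyadicBetween : ∀ K {a b} → 2 + a ≤ b → DyadicBetween K a b
dyadicBetween zero {a} a+2≤b = record
  { n = suc a
  ; a<n = ≤-refl
  ; n<b = a+2≤b
  ; leftOptions-≤G = λ { (_ , refl) → ≤G-refl }
  ; rightOptions-≥G = λ ()
  }
dyadicBetween (suc K) {a} {b} a+2≤b with 2 + ⌊ a /2⌋ ≤? ⌈ b /2⌉
... | yes gap = dyadicBetween-refine K (dyadicBetween K gap)
... | no no-gap = dyadicBetween-midpoint K a+2≤b (≤-pred (≰⇒> no-gap))

natAbove : ∀ K a → ∃ λ m → a < m * 2 ^ K × (∀ {w} → LeftOption (natG m) w → w ≤G dyadicℕ a K)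
natAbove zero a = suc a , subst (a <_) (sym (*-identityʳ (suc a))) ≤-refl , λ { (_ , refl) → ≤G-refl }
natAbove (suc K) a with natAbove K ⌊ a /2⌋
... | m , s<m , below =
  m , subst (a <_) (sym (*2^suc m K)) (≤-<-trans (n≤1+⌊n/2⌋*2 a) (*-monoˡ-≤ 2 s<m)) ,
  λ o → ≤G-trans (below o) (dyadicℕ-⌊/2⌋-≤G a K)

dyadicℕ-zero : ∀ k → dyadicℕ 0 k ≡ natG 0
dyadicℕ-zero zero = refl
dyadicℕ-zero (suc k) = dyadicℕ-zero k

natG-scale : ∀ m K → natG m ≡ dyadicℕ (m * 2 ^ K) K
natG-scale m K = trans (dyadicℕ-scale m K 0) (cong (dyadicℕ (m * 2 ^ K)) (+-identityʳ K))

natG-noRightOption : ∀ m {z} → ¬ RightOption (natG m) z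
natG-noRightOption zero ()
natG-noRightOption (suc m) ()

0<G-dyadicℕ-suc : ∀ n k → natG 0 <G dyadicℕ (suc n) k
0<G-dyadicℕ-suc n k = subst (_<G dyadicℕ (suc n) k) (dyadicℕ-zero k) (dyadicℕ-<G k (s≤s z≤n))

IsDyadic : Game → Set
IsDyadic g = ∃₂ λ m k → g ≈G dyadic m k

NonnegDyadic : Game → Set
NonnegDyadic g = ∃₂ λ a k → g ≈G dyadicℕ a k

isDyadic-negG : ∀ {g} → IsDyadic g → IsDyadic (negG g)
isDyadic-negG (Int.+ zero , k , g≈) =
  Int.+ 0 , 0 , ≈G-trans (negG-cong g≈) (subst (λ x → negG x ≈G natG 0) (sym (dyadicℕ-zero k)) negG-zero)
isDyadic-negG (Int.+ suc n , k , g≈) = -[1+ n ] , k , negG-cong g≈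
isDyadic-negG (-[1+ n ] , k , g≈) = Int.+ suc n , k , ≈G-trans (negG-cong g≈) (negG-involutive _)

isDyadic-nonneg : ∀ {g} → IsDyadic g → ¬ (g <G natG 0) → NonnegDyadic g
isDyadic-nonneg (Int.+ a , k , g≈) _ = a , k , g≈
isDyadic-nonneg (-[1+ n ] , k , g≈) g≮0 = ⊥-elim (g≮0 (≤G-<G-trans (proj₁ g≈) negD<0))
  where
  negD<0 : negG (dyadicℕ (suc n) k) <G natG 0
  negD<0 = <G-≤G-trans (negG-<G (0<G-dyadicℕ-suc n k)) (proj₁ negG-zero)

-- Every number is dyadic

-- A missing lower (upper) bound stands for −∞ (+∞).
infix 4 _<ₗ_ _<ᵤ_ _≤ₗ_ _≥ᵤ_

_<ₗ_ : Maybe Game → Game → Set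
nothing <ₗ x = ⊤
just l <ₗ x = ¬ (x ≤G l)

_<ᵤ_ : Game → Maybe Game → Set
x <ᵤ nothing = ⊤
x <ᵤ just h = ¬ (h ≤G x)

_≤ₗ_ : Game → Maybe Game → Set
w ≤ₗ nothing = ⊥
w ≤ₗ just l = w ≤G l

_≥ᵤ_ : Game → Maybe Game → Set
z ≥ᵤ nothing = ⊥
z ≥ᵤ just h = h ≤G z

Separated : Maybe Game → Maybe Game → Set
Separated (just l) (just h) = ¬ (h ≤G l)
Separated _ _ = ⊤

record Fits (lo hi : Maybe Game) (x : Game) : Set where
  field
    lo<x : lo <ₗ x
    x<hi : x <ᵤ hi
    leftOptions-≤lo : ∀ {w} → LeftOption x w → w ≤ₗ lo
    rightOptions-≥hi : ∀ {z} → RightOption x z → z ≥ᵤ hi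

Fits-cong : ∀ {lo lo′ hi hi′ x} → Pointwise _≈G_ lo lo′ → Pointwise _≈G_ hi hi′ →
            Fits lo′ hi′ x → Fits lo hi x
Fits-cong {x = x} lo≈ hi≈ fits = record
  { lo<x = lower-< lo≈ lo<x
  ; x<hi = upper-< hi≈ x<hi
  ; leftOptions-≤lo = λ o → lower-≤ lo≈ (leftOptions-≤lo o)
  ; rightOptions-≥hi = λ o → upper-≥ hi≈ (rightOptions-≥hi o)
  }
  where
  open Fits fits
  lower-< : ∀ {lo lo′} → Pointwise _≈G_ lo lo′ → lo′ <ₗ x → lo <ₗ x
  lower-< nothing _ = tt
  lower-< (just (l≤l′ , _)) x≰l′ x≤l = x≰l′ (≤G-trans x≤l l≤l′)
  upper-< : ∀ {hi hi′} → Pointwise _≈G_ hi hi′ → x <ᵤ hi′ → x <ᵤ hi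
  upper-< nothing _ = tt
  upper-< (just (_ , h′≤h)) h′≰x h≤x = h′≰x (≤G-trans h′≤h h≤x)
  lower-≤ : ∀ {lo lo′ w} → Pointwise _≈G_ lo lo′ → w ≤ₗ lo′ → w ≤ₗ lo
  lower-≤ (just (_ , l′≤l)) w≤l′ = ≤G-trans w≤l′ l′≤l
  upper-≥ : ∀ {hi hi′ z} → Pointwise _≈G_ hi hi′ → z ≥ᵤ hi′ → z ≥ᵤ hi
  upper-≥ (just (h≤h′ , _)) h′≤z = ≤G-trans h≤h′ h′≤z

Fits-negG : ∀ {lo hi x} → Fits lo hi x → Fits (Maybe.map negG hi) (Maybe.map negG lo) (negG x)
Fits-negG {lo} {hi} {x} fits = record
  { lo<x = negG-< hi x<hi
  ; x<hi = negG-> lo lo<x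
  ; leftOptions-≤lo = λ o → let (z , oz , w≡) = negG-leftOption⁻ {x} o
                            in subst (_≤ₗ Maybe.map negG hi) (sym w≡) (negG-≥ hi (rightOptions-≥hi oz))
  ; rightOptions-≥hi = λ o → let (w , ow , z≡) = negG-rightOption⁻ {x} o
                             in subst (_≥ᵤ Maybe.map negG lo) (sym z≡) (negG-≤ lo (leftOptions-≤lo ow))
  }
  where
  open Fits fits
  negG-< : ∀ hi → x <ᵤ hi → Maybe.map negG hi <ₗ negG x
  negG-< nothing _ = tt
  negG-< (just h) h≰x nx≤nh = h≰x (negG-reflects nx≤nh)
  negG-> : ∀ lo → lo <ₗ x → negG x <ᵤ Maybe.map negG lo
  negG-> nothing _ = tt
  negG-> (just l) x≰l nl≤nx = x≰l (negG-reflects nl≤nx)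
  negG-≥ : ∀ hi {z} → z ≥ᵤ hi → negG z ≤ₗ Maybe.map negG hi
  negG-≥ (just h) h≤z = negG-antitone h≤z
  negG-≤ : ∀ lo {w} → w ≤ₗ lo → negG w ≥ᵤ Maybe.map negG lo
  negG-≤ (just l) w≤l = negG-antitone w≤l

Separated-negG : ∀ lo hi → Separated lo hi → Separated (Maybe.map negG hi) (Maybe.map negG lo)
Separated-negG (just l) (just h) h≰l nl≤nh = h≰l (negG-reflects nl≤nh)
Separated-negG (just l) nothing _ = tt
Separated-negG nothing (just h) _ = tt
Separated-negG nothing nothing _ = tt

negG-involutive-bound : ∀ b → Pointwise _≈G_ b (Maybe.map negG (Maybe.map negG b))
negG-involutive-bound nothing = nothing
negG-involutive-bound (just g) = just (≈G-sym (negG-involutive g))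

fits-⟦∣⟧ : ∀ l r → Fits (just l) (just r) ⟦ l ∣ r ⟧
fits-⟦∣⟧ l r = record
  { lo<x = leftOption-≱ (Fin.zero , refl)
  ; x<hi = rightOption-≰ (Fin.zero , refl)
  ; leftOptions-≤lo = λ { (_ , refl) → ≤G-refl }
  ; rightOptions-≥hi = λ { (_ , refl) → ≤G-refl }
  }

fits-dyadicBetween : ∀ K {a b} → a < b → ∃₂ λ n j → Fits (just (dyadicℕ a K)) (just (dyadicℕ b K)) (dyadicℕ n j)
fits-dyadicBetween K {a} (s≤s a≤b) with m≤n⇒m<n∨m≡n a≤b
... | inj₂ refl = suc (a * 2) , suc K ,
  subst (Fits _ _) (sym (dyadicℕ-odd a K)) (fits-⟦∣⟧ (dyadicℕ a K) (dyadicℕ (suc a) K))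
... | inj₁ a<b′ = n , K , record
  { lo<x = proj₂ (dyadicℕ-<G K a<n)
  ; x<hi = proj₂ (dyadicℕ-<G K n<b)
  ; leftOptions-≤lo = leftOptions-≤G
  ; rightOptions-≥hi = rightOptions-≥G
  }
  where open DyadicBetween (dyadicBetween K (s≤s a<b′))

fits-natAbove : ∀ K a → ∃ λ m → Fits (just (dyadicℕ a K)) nothing (natG m)
fits-natAbove K a with natAbove K a
... | m , a<m , below = m , record
  { lo<x = subst (λ g → ¬ (g ≤G dyadicℕ a K)) (sym (natG-scale m K)) (proj₂ (dyadicℕ-<G K a<m))
  ; x<hi = tt
  ; leftOptions-≤lo = below
  ; rightOptions-≥hi = λ o → ⊥-elim (natG-noRightOption m o)
  }

fits-commonLevel : ∀ K {a b l h} → l ≈G dyadicℕ a K → h ≈G dyadicℕ b K → ¬ (h ≤G l) →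
                   ∃₂ λ n j → Fits (just l) (just h) (dyadicℕ n j)
fits-commonLevel K l≈ h≈ h≰l with fits-dyadicBetween K (dyadicℕ-≰G⇒> K b≰a)
  where
  b≰a = λ b≤a → h≰l (≤G-trans (proj₁ h≈) (≤G-trans b≤a (proj₂ l≈)))
... | n , j , fits = n , j , Fits-cong (just l≈) (just h≈) fits

fits-nonneg : ∀ {l} hi → NonnegDyadic l → All NonnegDyadic hi → Separated (just l) hi →
              ∃₂ λ n j → Fits (just l) hi (dyadicℕ n j)
fits-nonneg nothing (a , ka , l≈) nothing _ with fits-natAbove ka a
... | m , fits = m , 0 , Fits-cong (just l≈) nothing fits
fits-nonneg (just h) (a , ka , l≈) (just (b , kb , h≈)) =
  fits-commonLevel (kb + ka) (≈G-trans l≈ (≈G-reflexive (dyadicℕ-scale a kb ka)))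
                             (≈G-trans h≈ (≈G-reflexive b-scaled))
  where
  b-scaled : dyadicℕ b kb ≡ dyadicℕ (b * 2 ^ ka) (kb + ka)
  b-scaled = trans (dyadicℕ-scale b ka kb) (cong (dyadicℕ (b * 2 ^ ka)) (+-comm ka kb))

NonnegLower : Maybe Game → Set
NonnegLower nothing = ⊥
NonnegLower (just l) = natG 0 ≤G l

NonposUpper : Maybe Game → Set
NonposUpper nothing = ⊥
NonposUpper (just h) = h ≤G natG 0

nonnegLower? : ∀ lo → Dec (NonnegLower lo)
nonnegLower? nothing = no λ ()
nonnegLower? (just l) = natG 0 ≤G? l

nonposUpper? : ∀ hi → Dec (NonposUpper hi)
nonposUpper? nothing = no λ ()
nonposUpper? (just h) = h ≤G? natG 0

Fitting : Maybe Game → Maybe Game → Set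
Fitting lo hi = ∃ λ x → Fits lo hi x × IsDyadic x

fitting-nonneg : ∀ lo hi → NonnegLower lo → All IsDyadic lo → All IsDyadic hi → Separated lo hi → Fitting lo hi
fitting-nonneg (just l) hi 0≤l (just dl) dhi sep with fits-nonneg hi l≥0 (upper≥0 hi dhi sep) sep
  where
  l≥0 : NonnegDyadic l
  l≥0 = isDyadic-nonneg dl λ (_ , 0≰l) → 0≰l 0≤l
  upper≥0 : ∀ hi → All IsDyadic hi → Separated (just l) hi → All NonnegDyadic hi
  upper≥0 nothing nothing _ = nothing
  upper≥0 (just h) (just dh) h≰l = just (isDyadic-nonneg dh λ (h≤0 , _) → h≰l (≤G-trans h≤0 0≤l))
... | n , j , fits = dyadicℕ n j , fits , Int.+ n , j , ≈G-refl

fitting-nonpos : ∀ lo hi → NonposUpper hi → All IsDyadic lo → All IsDyadic hi → Separated lo hi → Fitting lo hi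
fitting-nonpos lo (just h) h≤0 dlo (just dh) sep
  with fitting-nonneg (just (negG h)) (Maybe.map negG lo) 0≤-h (just (isDyadic-negG dh)) (negate dlo)
                      (Separated-negG lo (just h) sep)
  where
  0≤-h : natG 0 ≤G negG h
  0≤-h = ≤G-trans (proj₂ negG-zero) (negG-antitone h≤0)
  negate : ∀ {lo} → All IsDyadic lo → All IsDyadic (Maybe.map negG lo)
  negate nothing = nothing
  negate (just d) = just (isDyadic-negG d)
... | x , fits , dx =
  negG x ,
  Fits-cong (negG-involutive-bound lo) (negG-involutive-bound (just h)) (Fits-negG fits) ,
  isDyadic-negG dx

fits-zero : ∀ lo hi → ¬ NonnegLower lo → ¬ NonposUpper hi → Fits lo hi (natG 0)
fits-zero lo hi lo≱0 hi≰0 = record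
  { lo<x = lower lo lo≱0
  ; x<hi = upper hi hi≰0
  ; leftOptions-≤lo = λ ()
  ; rightOptions-≥hi = λ ()
  }
  where
  lower : ∀ lo → ¬ NonnegLower lo → lo <ₗ natG 0
  lower nothing _ = tt
  lower (just l) 0≰l = 0≰l
  upper : ∀ hi → ¬ NonposUpper hi → natG 0 <ᵤ hi
  upper nothing _ = tt
  upper (just h) h≰0 = h≰0

fitting : ∀ lo hi → All IsDyadic lo → All IsDyadic hi → Separated lo hi → Fitting lo hi
fitting lo hi dlo dhi sep with nonnegLower? lo | nonposUpper? hi
... | yes lo≥0 | _ = fitting-nonneg lo hi lo≥0 dlo dhi sep
... | no _ | yes hi≤0 = fitting-nonpos lo hi hi≤0 dlo dhi sep
... | no lo≱0 | no hi≰0 = natG 0 , fits-zero lo hi lo≱0 hi≰0 , Int.+ 0 , 0 , ≈G-refl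

module _ {A : Set} {_≼_ : A → A → Set} (≼-refl : Reflexive _≼_) (≼-trans : Transitive _≼_) where

  argmax : ∀ {m} (F : Fin (suc m) → A) → (∀ i i′ → F i ≼ F i′ ⊎ F i′ ≼ F i) →
           ∃ λ i → ∀ i′ → F i′ ≼ F i
  argmax {zero} F total = Fin.zero , λ { Fin.zero → ≼-refl }
  argmax {suc m} F total with argmax (λ i → F (Fin.suc i)) (λ i i′ → total (Fin.suc i) (Fin.suc i′))
  ... | k , max with total (Fin.suc k) Fin.zero
  ...   | inj₁ Fk≼F0 = Fin.zero , λ { Fin.zero → ≼-refl ; (Fin.suc i′) → ≼-trans (max i′) Fk≼F0 }
  ...   | inj₂ F0≼Fk = Fin.suc k , λ { Fin.zero → F0≼Fk ; (Fin.suc i′) → max i′ }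

record IsMaximum {m} (L : Fin m → Game) (lo : Maybe Game) : Set where
  field
    bounds : ∀ i → L i ≤ₗ lo
    attained : ∀ {w} → w ≤ₗ lo → ∃ λ i → w ≤G L i

record IsMinimum {n} (R : Fin n → Game) (hi : Maybe Game) : Set where
  field
    bounds : ∀ j → R j ≥ᵤ hi
    attained : ∀ {z} → z ≥ᵤ hi → ∃ λ j → R j ≤G z

maximum : ∀ {m} (L : Fin m → Game) → (∀ i → IsNumber (L i)) → (∀ i → IsDyadic (L i)) →
          ∃ λ lo → IsMaximum L lo × All IsDyadic lo
maximum {zero} L _ _ = nothing , record { bounds = λ () ; attained = λ () } , nothing
maximum {suc m} L nL dL with argmax {_≼_ = _≤G_} ≤G-refl ≤G-trans L (λ i i′ → ≤G-total (nL i) (nL i′))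
... | i , max = just (L i) , record { bounds = max ; attained = λ w≤ → i , w≤ } , just (dL i)

minimum : ∀ {n} (R : Fin n → Game) → (∀ j → IsNumber (R j)) → (∀ j → IsDyadic (R j)) →
          ∃ λ hi → IsMinimum R hi × All IsDyadic hi
minimum {zero} R _ _ = nothing , record { bounds = λ () ; attained = λ () } , nothing
minimum {suc n} R nR dR with argmax {_≼_ = flip _≤G_} ≤G-refl (flip ≤G-trans) R (λ j j′ → ≤G-total (nR j′) (nR j))
... | j , min = just (R j) , record { bounds = min ; attained = λ ≤z → j , ≤z } , just (dR j)

separated : ∀ {m n} {L : Fin m → Game} {R : Fin n → Game} {lo hi} → IsMaximum L lo → IsMinimum R hi →
            (∀ i j → ¬ (R j ≤G L i)) → Separated lo hi
separated {lo = just l} {just h} max min apart h≤l =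
  let (j , Rj≤l) = IsMinimum.attained min h≤l
      (i , Rj≤Li) = IsMaximum.attained max Rj≤l
  in apart i j Rj≤Li
separated {lo = just l} {nothing} _ _ _ = tt
separated {lo = nothing} {just h} _ _ _ = tt
separated {lo = nothing} {nothing} _ _ _ = tt

fits⇒≈G : ∀ {m n} {L : Fin m → Game} {R : Fin n → Game} {lo hi x} →
          IsMaximum L lo → IsMinimum R hi → Fits lo hi x → ⟨ L ∣ R ⟩ ≈G x
fits⇒≈G {L = L} {R} {lo} {hi} {x} max min fits =
  ≤G-intro (λ { (i , refl) → below-lo lo (IsMaximum.bounds max i) lo<x })
           (λ o z≤G → let (j , Rj≤z) = IsMinimum.attained min (rightOptions-≥hi o)
                      in rightOption-≰ (j , refl) (≤G-trans Rj≤z z≤G)) ,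
  ≤G-intro (λ o G≤w → let (i , w≤Li) = IsMaximum.attained max (leftOptions-≤lo o)
                      in leftOption-≱ (i , refl) (≤G-trans G≤w w≤Li))
           (λ { (j , refl) → above-hi hi (IsMinimum.bounds min j) x<hi })
  where
  open Fits fits
  below-lo : ∀ lo {w} → w ≤ₗ lo → lo <ₗ x → ¬ (x ≤G w)
  below-lo (just l) w≤l x≰l x≤w = x≰l (≤G-trans x≤w w≤l)
  above-hi : ∀ hi {z} → z ≥ᵤ hi → x <ᵤ hi → ¬ (z ≤G x)
  above-hi (just h) h≤z h≰x z≤x = h≰x (≤G-trans h≤z z≤x)

number⇒dyadic : ∀ {G} → IsNumber G → IsDyadic G
number⇒dyadic {⟨ L ∣ R ⟩} (nL , nR , apart)
  with maximum L nL (λ i → number⇒dyadic (nL i)) | minimum R nR (λ j → number⇒dyadic (nR j))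
... | lo , max , dlo | hi , min , dhi with fitting lo hi dlo dhi (separated max min apart)
... | x , fits , m , k , x≈ = m , k , ≈G-trans (fits⇒≈G max min fits) x≈

-- Positions and moves

infixl 6 _[_]≔_

_[_]≔_ : (ℕ → Bool) → ℕ → Bool → ℕ → Bool
(f [ i ]≔ b) m = if m ≡ᵇ i then b else f m

≡ᵇ-true⇒≡ : ∀ {m n} → (m ≡ᵇ n) ≡ true → m ≡ n
≡ᵇ-true⇒≡ {m} {n} e = ≡ᵇ⇒≡ m n (subst T (sym e) tt)

[]≔-cong : ∀ {f g} i b → f ≗ g → f [ i ]≔ b ≗ g [ i ]≔ b
[]≔-cong i b f≗g m with m ≡ᵇ i
... | true = refl
... | false = f≗g m

[]≔-updated : ∀ f i b → (f [ i ]≔ b) i ≡ b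
[]≔-updated f i b with i ≡ᵇ i in e
... | true = refl
... | false = ⊥-elim (subst T e (≡⇒≡ᵇ i i refl))

[]≔-other : ∀ f {i m} b → m ≢ i → (f [ i ]≔ b) m ≡ f m
[]≔-other f {i} {m} b m≢i with m ≡ᵇ i in e
... | true = ⊥-elim (m≢i (≡ᵇ-true⇒≡ e))
... | false = refl

[]≔-other² : ∀ f {a b m} x y → m ≢ a → m ≢ b → (f [ a ]≔ x [ b ]≔ y) m ≡ f m
[]≔-other² f {a} x y m≢a m≢b = trans ([]≔-other (f [ a ]≔ x) y m≢b) ([]≔-other f x m≢a)

[]≔-comm : ∀ f {i j} a b → i ≢ j → f [ i ]≔ a [ j ]≔ b ≗ f [ j ]≔ b [ i ]≔ a
[]≔-comm f {i} {j} a b i≢j m with m ≡ᵇ i in ei | m ≡ᵇ j in ej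
... | true | true = ⊥-elim (i≢j (trans (sym (≡ᵇ-true⇒≡ {m} ei)) (≡ᵇ-true⇒≡ {m} ej)))
... | true | false = refl
... | false | true = refl
... | false | false = refl

[]≔-idem : ∀ f i a b → f [ i ]≔ a [ i ]≔ b ≗ f [ i ]≔ b
[]≔-idem f i a b m with m ≡ᵇ i
... | true = refl
... | false = refl

[]≔-id : ∀ f {i b} → f i ≡ b → f [ i ]≔ b ≗ f
[]≔-id f {i} fi≡b m with m ≡ᵇ i in e
... | true = sym (subst (λ x → f x ≡ _) (sym (≡ᵇ-true⇒≡ e)) fi≡b)
... | false = refl

get-set : ∀ xs i b → b ≡ false ⊎ i < length xs → get (set xs i b) ≗ get xs [ i ]≔ b
get-set [] i .false (inj₁ refl) m with m ≡ᵇ i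
... | true = refl
... | false = refl
get-set (x ∷ xs) zero b _ zero = refl
get-set (x ∷ xs) zero b _ (suc m) = refl
get-set (x ∷ xs) (suc i) b _ zero = refl
get-set (x ∷ xs) (suc i) b (inj₁ b≡false) (suc m) = get-set xs i b (inj₁ b≡false) m
get-set (x ∷ xs) (suc i) b (inj₂ (s≤s i<n)) (suc m) = get-set xs i b (inj₂ i<n) m

get⇒< : ∀ xs {i} → get xs i ≡ true → i < length xs
get⇒< (x ∷ xs) {zero} _ = s≤s z≤n
get⇒< (x ∷ xs) {suc i} xs[i] = s≤s (get⇒< xs xs[i])

consTrimmed : Bool → List Bool → List Bool
consTrimmed b [] = if b then b ∷ [] else []
consTrimmed b (c ∷ cs) = b ∷ c ∷ cs

trim-∷ : ∀ b bs → trim (b ∷ bs) ≡ consTrimmed b (trim bs)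
trim-∷ b bs with trim bs
... | [] = refl
... | c ∷ cs = refl

get-consTrimmed : ∀ b {t bs} → get t ≗ get bs → get (consTrimmed b t) ≗ get (b ∷ bs)
get-consTrimmed true {[]} t≗bs zero = refl
get-consTrimmed false {[]} t≗bs zero = refl
get-consTrimmed true {[]} t≗bs (suc m) = t≗bs m
get-consTrimmed false {[]} t≗bs (suc m) = t≗bs m
get-consTrimmed b {c ∷ cs} t≗bs zero = refl
get-consTrimmed b {c ∷ cs} t≗bs (suc m) = t≗bs m

get-trim : ∀ xs → get (trim xs) ≗ get xs
get-trim [] m = refl
get-trim (b ∷ bs) m rewrite trim-∷ b bs = get-consTrimmed b {trim bs} (get-trim bs) m

trim≡[] : ∀ xs → (∀ m → get xs m ≡ false) → trim xs ≡ []
trim≡[] [] _ = refl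
trim≡[] (b ∷ bs) all-false rewrite trim-∷ b bs | trim≡[] bs (λ m → all-false (suc m)) | all-false 0 = refl

trim-≗ : ∀ xs ys → get xs ≗ get ys → trim xs ≡ trim ys
trim-≗ [] ys xs≗ys = sym (trim≡[] ys (λ m → sym (xs≗ys m)))
trim-≗ (x ∷ xs) [] xs≗ys = trim≡[] (x ∷ xs) xs≗ys
trim-≗ (x ∷ xs) (y ∷ ys) xs≗ys rewrite trim-∷ x xs | trim-∷ y ys | xs≗ys 0 =
  cong (consTrimmed y) (trim-≗ xs ys (λ m → xs≗ys (suc m)))

get-set² : ∀ xs a x b → x ≡ false ⊎ a < length xs →
           get (set (set xs a x) b false) ≗ get xs [ a ]≔ x [ b ]≔ false
get-set² xs a x b side m =
  trans (get-set (set xs a x) b false (inj₁ refl) m) ([]≔-cong b false (get-set xs a x side) m)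

get-move : ∀ xs a x b → x ≡ false ⊎ a < length xs →
           get (trim (set (set xs a x) b false)) ≗ get xs [ a ]≔ x [ b ]≔ false
get-move xs a x b side m = trans (get-trim (set (set xs a x) b false) m) (get-set² xs a x b side m)

data LeftMove (p q : Position) : Set where
  leftMove : ∀ {i j} → i < j → get p i ≡ true → get p j ≡ true →
             q ≡ trim (set (set p i false) j false) → LeftMove p q

data RightMove (p q : Position) : Set where
  rightMove : ∀ {k l} → k < l → get p k ≡ false → get p l ≡ true →
              q ≡ trim (set (set p k true) l false) → RightMove p q

leftMove-≗ : ∀ {p i j} xs → i ≢ j → get p i ≡ true → get p j ≡ true →
             get xs ≗ get p [ i ]≔ false [ j ]≔ false → LeftMove p (trim xs)
leftMove-≗ {p} {i} {j} xs i≢j p[i] p[j] xs≗ with <-cmp i j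
... | tri< i<j _ _ = leftMove i<j p[i] p[j] (trim-≗ xs (set (set p i false) j false) λ m →
  trans (xs≗ m) (sym (get-set² p i false j (inj₁ refl) m)))
... | tri≈ _ i≡j _ = ⊥-elim (i≢j i≡j)
... | tri> _ _ j<i = leftMove j<i p[j] p[i] (trim-≗ xs (set (set p j false) i false) λ m →
  trans (xs≗ m) (trans ([]≔-comm (get p) false false i≢j m) (sym (get-set² p j false i (inj₁ refl) m))))

bits-≢ : ∀ {f : ℕ → Bool} {x y} → f x ≡ false → f y ≡ true → x ≢ y
bits-≢ fx fy refl with trans (sym fx) fy
... | ()

module _ where
  open SetoidReasoning (ℕ →-setoid Bool)

  []≔-restore : ∀ f {k a} x → f k ≡ false → a ≢ k → f [ k ]≔ true [ a ]≔ x [ k ]≔ false ≗ f [ a ]≔ x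
  []≔-restore f {k} {a} x f[k] a≢k = begin
    f [ k ]≔ true [ a ]≔ x [ k ]≔ false  ≈⟨ []≔-comm (f [ k ]≔ true) x false a≢k ⟩
    f [ k ]≔ true [ k ]≔ false [ a ]≔ x  ≈⟨ []≔-cong a x ([]≔-idem f k true false) ⟩
    f [ k ]≔ false [ a ]≔ x              ≈⟨ []≔-cong a x ([]≔-id f f[k]) ⟩
    f [ a ]≔ x                           ∎

  []≔-comm² : ∀ f {i j k l} a b c d → i ≢ k → i ≢ l → j ≢ k → j ≢ l →
              f [ i ]≔ a [ j ]≔ b [ k ]≔ c [ l ]≔ d ≗ f [ k ]≔ c [ l ]≔ d [ i ]≔ a [ j ]≔ b
  []≔-comm² f {i} {j} {k} {l} a b c d i≢k i≢l j≢k j≢l = begin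
    f [ i ]≔ a [ j ]≔ b [ k ]≔ c [ l ]≔ d  ≈⟨ []≔-cong l d ([]≔-comm (f [ i ]≔ a) b c j≢k) ⟩
    f [ i ]≔ a [ k ]≔ c [ j ]≔ b [ l ]≔ d  ≈⟨ []≔-cong l d ([]≔-cong j b ([]≔-comm f a c i≢k)) ⟩
    f [ k ]≔ c [ i ]≔ a [ j ]≔ b [ l ]≔ d  ≈⟨ []≔-comm (f [ k ]≔ c [ i ]≔ a) b d j≢l ⟩
    f [ k ]≔ c [ i ]≔ a [ l ]≔ d [ j ]≔ b  ≈⟨ []≔-cong j b ([]≔-comm (f [ k ]≔ c) a d i≢l) ⟩
    f [ k ]≔ c [ l ]≔ d [ i ]≔ a [ j ]≔ b  ∎

module AfterRightMove (p : Position) {k l} (k<l : k < l) (p[k] : get p k ≡ false) (p[l] : get p l ≡ true)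
  where
  open SetoidReasoning (ℕ →-setoid Bool)

  B : Position
  B = trim (set (set p k true) l false)

  B≗ : get B ≗ get p [ k ]≔ true [ l ]≔ false
  B≗ = get-move p k true l (inj₂ (<-trans k<l (get⇒< p p[l])))

  B[k] : get B k ≡ true
  B[k] = trans (B≗ k) (trans ([]≔-other (get p [ k ]≔ true) false (<⇒≢ k<l)) ([]≔-updated (get p) k true))

  B-keeps : ∀ {m} → get p m ≡ true → m ≢ l → get B m ≡ true
  B-keeps {m} p[m] m≢l =
    trans (B≗ m) (trans ([]≔-other² (get p) true false (bits-≢ p[k] p[m] ∘ sym) m≢l) p[m])

  B-cleared-k : get B [ k ]≔ false ≗ get p [ l ]≔ false
  B-cleared-k = begin
    get B [ k ]≔ false                           ≈⟨ []≔-cong k false B≗ ⟩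
    get p [ k ]≔ true [ l ]≔ false [ k ]≔ false  ≈⟨ []≔-restore (get p) false p[k] (<⇒≢ k<l ∘ sym) ⟩
    get p [ l ]≔ false                           ∎

  onFirstCoin : ∀ {j} → l < j → get p j ≡ true → LeftMove B (trim (set (set p l false) j false))
  onFirstCoin {j} l<j p[j] =
    leftMove-≗ (set (set p l false) j false) (bits-≢ p[k] p[j]) B[k] (B-keeps p[j] (<⇒≢ l<j ∘ sym)) (begin
      get (set (set p l false) j false)  ≈⟨ get-set² p l false j (inj₁ refl) ⟩
      get p [ l ]≔ false [ j ]≔ false    ≈⟨ []≔-cong j false B-cleared-k ⟨
      get B [ k ]≔ false [ j ]≔ false    ∎)

  onSecondCoin : ∀ {i} → i < l → get p i ≡ true → LeftMove B (trim (set (set p i false) l false))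
  onSecondCoin {i} i<l p[i] =
    leftMove-≗ (set (set p i false) l false) (bits-≢ p[k] p[i]) B[k] (B-keeps p[i] (<⇒≢ i<l)) (begin
      get (set (set p i false) l false)  ≈⟨ get-set² p i false l (inj₁ refl) ⟩
      get p [ i ]≔ false [ l ]≔ false    ≈⟨ []≔-comm (get p) false false (<⇒≢ i<l) ⟩
      get p [ l ]≔ false [ i ]≔ false    ≈⟨ []≔-cong i false B-cleared-k ⟨
      get B [ k ]≔ false [ i ]≔ false    ∎)

  awayFromCoins : ∀ {i j} → i < j → get p i ≡ true → get p j ≡ true → l ≢ i → l ≢ j →
                  ∃ λ C → RightMove (trim (set (set p i false) j false)) C × LeftMove B C
  awayFromCoins {i} {j} i<j p[i] p[j] l≢i l≢j =
    trim (set (set A k true) l false) , rightMove k<l A[k] A[l] refl ,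
    leftMove-≗ (set (set A k true) l false) (<⇒≢ i<j) (B-keeps p[i] (l≢i ∘ sym)) (B-keeps p[j] (l≢j ∘ sym))
      (begin
        get (set (set A k true) l false)                          ≈⟨ get-set² A k true l (inj₂ k<∣A∣) ⟩
        get A [ k ]≔ true [ l ]≔ false                            ≈⟨ []≔-cong l false ([]≔-cong k true A≗) ⟩
        get p [ i ]≔ false [ j ]≔ false [ k ]≔ true [ l ]≔ false  ≈⟨ []≔-comm² (get p) true false false false
                                                                        k≢i k≢j l≢i l≢j ⟨
        get p [ k ]≔ true [ l ]≔ false [ i ]≔ false [ j ]≔ false  ≈⟨ []≔-cong j false ([]≔-cong i false B≗) ⟨
        get B [ i ]≔ false [ j ]≔ false                           ∎)
    where
    A : Position
    A = trim (set (set p i false) j false)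
    A≗ : get A ≗ get p [ i ]≔ false [ j ]≔ false
    A≗ = get-move p i false j (inj₁ refl)
    k≢i : k ≢ i
    k≢i = bits-≢ p[k] p[i]
    k≢j : k ≢ j
    k≢j = bits-≢ p[k] p[j]
    A[k] : get A k ≡ false
    A[k] = trans (A≗ k) (trans ([]≔-other² (get p) false false k≢i k≢j) p[k])
    A[l] : get A l ≡ true
    A[l] = trans (A≗ l) (trans ([]≔-other² (get p) false false l≢i l≢j) p[l])
    k<∣A∣ : k < length A
    k<∣A∣ = <-trans k<l (get⇒< A A[l])

exchange : ∀ {p A B} → LeftMove p A → RightMove p B → LeftMove B A ⊎ ∃ λ C → RightMove A C × LeftMove B C
exchange {p} (leftMove {i} {j} i<j p[i] p[j] refl) (rightMove {k} {l} k<l p[k] p[l] refl) with l ≟ i | l ≟ j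
... | yes refl | _ = inj₁ (AfterRightMove.onFirstCoin p k<l p[k] p[l] i<j p[j])
... | no _ | yes refl = inj₁ (AfterRightMove.onSecondCoin p k<l p[k] p[l] i<j p[i])
... | no l≢i | no l≢j = inj₂ (AfterRightMove.awayFromCoins p k<l p[k] p[l] i<j p[i] p[j] l≢i l≢j)

-- Weight

weightFrom : ℕ → List Bool → ℕ
weightFrom _ [] = 0
weightFrom k (b ∷ bs) = (if b then k else 0) + weightFrom (suc k) bs

weightFrom-unique : ∀ {g : ℕ → List Bool → ℕ} → (∀ k → g k [] ≡ 0) →
                    (∀ k b bs → g k (b ∷ bs) ≡ (if b then k else 0) + g (suc k) bs) →
                    ∀ k xs → g k xs ≡ weightFrom k xs
weightFrom-unique nil cons k [] = nil k
weightFrom-unique {g} nil cons k (b ∷ bs) =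
  trans (cons k b bs) (cong ((if b then k else 0) +_) (weightFrom-unique {g} nil cons (suc k) bs))

-- `weight` recurses through an anonymous local helper; abstracting the literal 1 lets
-- unification recover that helper as the `g` of weightFrom-unique.
weight≡weightFrom : ∀ p → weight p ≡ weightFrom 1 p
weight≡weightFrom with weightFrom-unique (λ _ → refl) (λ _ _ _ → refl)
... | unique with 1
...   | k = unique k

weightFrom-consTrimmed : ∀ k b t → weightFrom k (consTrimmed b t) ≡ (if b then k else 0) + weightFrom (suc k) t
weightFrom-consTrimmed k true [] = refl
weightFrom-consTrimmed k false [] = refl
weightFrom-consTrimmed k b (c ∷ cs) = refl

weightFrom-trim : ∀ k xs → weightFrom k (trim xs) ≡ weightFrom k xs
weightFrom-trim k [] = refl
weightFrom-trim k (b ∷ bs) rewrite trim-∷ b bs =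
  trans (weightFrom-consTrimmed k b (trim bs)) (cong ((if b then k else 0) +_) (weightFrom-trim (suc k) bs))

k+w≡w+[k+0] : ∀ k w → k + w ≡ w + (k + 0)
k+w≡w+[k+0] = solve-∀

c+[w+[1+k+i]]≡c+w+[k+1+i] : ∀ c w k i → c + (w + (suc k + i)) ≡ c + w + (k + suc i)
c+[w+[1+k+i]]≡c+w+[k+1+i] = solve-∀

weightFrom-clear : ∀ k xs i → get xs i ≡ true → weightFrom k xs ≡ weightFrom k (set xs i false) + (k + i)
weightFrom-clear k (true ∷ xs) zero refl = k+w≡w+[k+0] k (weightFrom (suc k) xs)
weightFrom-clear k (x ∷ xs) (suc i) xs[i] =
  trans (cong ((if x then k else 0) +_) (weightFrom-clear (suc k) xs i xs[i]))
        (c+[w+[1+k+i]]≡c+w+[k+1+i] (if x then k else 0) (weightFrom (suc k) (set xs i false)) k i)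

weightFrom-put : ∀ k xs i → get xs i ≡ false → i < length xs →
                 weightFrom k (set xs i true) ≡ weightFrom k xs + (k + i)
weightFrom-put k (false ∷ xs) zero refl _ = k+w≡w+[k+0] k (weightFrom (suc k) xs)
weightFrom-put k (x ∷ xs) (suc i) xs[i] (s≤s i<n) =
  trans (cong ((if x then k else 0) +_) (weightFrom-put (suc k) xs i xs[i] i<n))
        (c+[w+[1+k+i]]≡c+w+[k+1+i] (if x then k else 0) (weightFrom (suc k) xs) k i)

weight-trim : ∀ xs → weight (trim xs) ≡ weightFrom 1 xs
weight-trim xs = trans (weight≡weightFrom (trim xs)) (weightFrom-trim 1 xs)

leftMove-decreasing : ∀ {p q} → LeftMove p q → weight q < weight p
leftMove-decreasing {p} (leftMove {i} {j} i<j p[i] p[j] refl) =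
  subst₂ _<_ (sym (weight-trim (set p₁ j false))) (sym (weight≡weightFrom p)) (begin-strict
    weightFrom 1 (set p₁ j false)            <⟨ m<m+n _ z<s ⟩
    weightFrom 1 (set p₁ j false) + (1 + j)  ≡⟨ weightFrom-clear 1 p₁ j p₁[j] ⟨
    weightFrom 1 p₁                          ≤⟨ m≤m+n _ (1 + i) ⟩
    weightFrom 1 p₁ + (1 + i)                ≡⟨ weightFrom-clear 1 p i p[i] ⟨
    weightFrom 1 p                           ∎)
  where
  open ≤-Reasoning
  p₁ = set p i false
  p₁[j] : get p₁ j ≡ true
  p₁[j] = trans (get-set p i false (inj₁ refl) j) (trans ([]≔-other (get p) false (<⇒≢ i<j ∘ sym)) p[j])

rightMove-decreasing : ∀ {p q} → RightMove p q → weight q < weight p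
rightMove-decreasing {p} (rightMove {k} {l} k<l p[k] p[l] refl) =
  subst₂ _<_ (sym (weight-trim (set p₁ l false))) (sym (weight≡weightFrom p)) (+-cancelʳ-< (1 + k) _ _ (begin-strict
    weightFrom 1 (set p₁ l false) + (1 + k)  <⟨ +-monoʳ-< (weightFrom 1 (set p₁ l false)) (s≤s k<l) ⟩
    weightFrom 1 (set p₁ l false) + (1 + l)  ≡⟨ weightFrom-clear 1 p₁ l p₁[l] ⟨
    weightFrom 1 p₁                          ≡⟨ weightFrom-put 1 p k p[k] (<-trans k<l (get⇒< p p[l])) ⟩
    weightFrom 1 p + (1 + k)                 ∎))
  where
  open ≤-Reasoning
  p₁ = set p k true
  p₁[l] : get p₁ l ≡ true
  p₁[l] = trans (get-set p k true (inj₂ (<-trans k<l (get⇒< p p[l]))) l)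
                (trans ([]≔-other (get p) true (<⇒≢ k<l ∘ sym)) p[l])

-- Game values of positions

∈-pairs⁻ : ∀ {n i j} → (i , j) ∈ pairs n → i < j × j < n
∈-pairs⁻ {n} i,j∈ with find (∈-concatMap⁻ (λ j → map (λ i → (i , j)) (upTo j)) {xs = upTo n} i,j∈)
... | j , j∈ , i,j∈′ with ∈-map⁻ (λ i → (i , j)) i,j∈′
...   | i , i∈ , refl = ∈-upTo⁻ i∈ , ∈-upTo⁻ j∈

∈-pairs⁺ : ∀ {n i j} → i < j → j < n → (i , j) ∈ pairs n
∈-pairs⁺ {n} {i} {j} i<j j<n = ∈-concatMap⁺ (λ j → map (λ i → (i , j)) (upTo j)) {xs = upTo n}
  (lose {P = λ j′ → (i , j) ∈ map (λ i → (i , j′)) (upTo j′)} (∈-upTo⁺ j<n) (∈-map⁺ (λ i → (i , j)) (∈-upTo⁺ i<j)))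

T-∧⁻ : ∀ {a b} → T (a ∧ b) → a ≡ true × b ≡ true
T-∧⁻ {true} {true} _ = refl , refl

T-not∧⁻ : ∀ {a b} → T (not a ∧ b) → a ≡ false × b ≡ true
T-not∧⁻ {false} {true} _ = refl , refl

leftOutcome : Position → ℕ × ℕ → Position
leftOutcome p ij = trim (set (set p (proj₁ ij) false) (proj₂ ij) false)

rightOutcome : Position → ℕ × ℕ → Position
rightOutcome p kl = trim (set (set p (proj₁ kl) true) (proj₂ kl) false)

leftLegal? : ∀ p (ij : ℕ × ℕ) → Dec (T (get p (proj₁ ij) ∧ get p (proj₂ ij)))
leftLegal? p ij = T? (get p (proj₁ ij) ∧ get p (proj₂ ij))

rightLegal? : ∀ p (kl : ℕ × ℕ) → Dec (T (not (get p (proj₁ kl)) ∧ get p (proj₂ kl)))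
rightLegal? p kl = T? (not (get p (proj₁ kl)) ∧ get p (proj₂ kl))

∈-leftMoves⁻ : ∀ {p q} → q ∈ leftMoves p → LeftMove p q
∈-leftMoves⁻ {p} q∈ with ∈-map∘filter⁻ (leftOutcome p) (leftLegal? p) {xs = pairs (length p)} q∈
... | _ , i,j∈ , q≡ , bits =
  leftMove (proj₁ (∈-pairs⁻ {length p} i,j∈)) (proj₁ (T-∧⁻ bits)) (proj₂ (T-∧⁻ bits)) q≡

∈-leftMoves⁺ : ∀ {p q} → LeftMove p q → q ∈ leftMoves p
∈-leftMoves⁺ {p} (leftMove {i} {j} i<j p[i] p[j] q≡) =
  ∈-map∘filter⁺ (leftOutcome p) (leftLegal? p) {xs = pairs (length p)}
    ((i , j) , ∈-pairs⁺ i<j (get⇒< p p[j]) , q≡ , subst₂ (λ a b → T (a ∧ b)) (sym p[i]) (sym p[j]) tt)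

∈-rightMoves⁻ : ∀ {p q} → q ∈ rightMoves p → RightMove p q
∈-rightMoves⁻ {p} q∈ with ∈-map∘filter⁻ (rightOutcome p) (rightLegal? p) {xs = pairs (length p)} q∈
... | _ , k,l∈ , q≡ , bits =
  rightMove (proj₁ (∈-pairs⁻ {length p} k,l∈)) (proj₁ (T-not∧⁻ bits)) (proj₂ (T-not∧⁻ bits)) q≡

∈-rightMoves⁺ : ∀ {p q} → RightMove p q → q ∈ rightMoves p
∈-rightMoves⁺ {p} (rightMove {k} {l} k<l p[k] p[l] q≡) =
  ∈-map∘filter⁺ (rightOutcome p) (rightLegal? p) {xs = pairs (length p)}
    ((k , l) , ∈-pairs⁺ k<l (get⇒< p p[l]) , q≡ , subst₂ (λ a b → T (not a ∧ b)) (sym p[k]) (sym p[l]) tt)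

lookup-map⁻ : ∀ {A B : Set} (g : A → B) xs i → ∃ λ x → x ∈ xs × lookup (map g xs) i ≡ g x
lookup-map⁻ g xs i = ∈-map⁻ g (∈-lookup i)

lookup-map⁺ : ∀ {A B : Set} (g : A → B) {xs x} → x ∈ xs → ∃ λ i → lookup (map g xs) i ≡ g x
lookup-map⁺ g x∈ = index (∈-map⁺ g x∈) , sym (lookup-index (∈-map⁺ g x∈))

gameFuel-leftOptions : ∀ f p {P : Game → Set} → (∀ {q} → LeftMove p q → P (gameFuel f q)) →
                       ∀ {w} → LeftOption (gameFuel (suc f) p) w → P w
gameFuel-leftOptions f p {P} P-moves (i , refl) with lookup-map⁻ (gameFuel f) (leftMoves p) i
... | q , q∈ , w≡ = subst P (sym w≡) (P-moves (∈-leftMoves⁻ q∈))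

gameFuel-rightOptions : ∀ f p {P : Game → Set} → (∀ {q} → RightMove p q → P (gameFuel f q)) →
                        ∀ {z} → RightOption (gameFuel (suc f) p) z → P z
gameFuel-rightOptions f p {P} P-moves (i , refl) with lookup-map⁻ (gameFuel f) (rightMoves p) i
... | q , q∈ , z≡ = subst P (sym z≡) (P-moves (∈-rightMoves⁻ q∈))

gameFuel-leftOption⁺ : ∀ f {p q} → LeftMove p q → LeftOption (gameFuel (suc f) p) (gameFuel f q)
gameFuel-leftOption⁺ f move = lookup-map⁺ (gameFuel f) (∈-leftMoves⁺ move)

gameFuel-rightOption⁺ : ∀ f {p q} → RightMove p q → RightOption (gameFuel (suc f) p) (gameFuel f q)
gameFuel-rightOption⁺ f move = lookup-map⁺ (gameFuel f) (∈-rightMoves⁺ move)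

fuel-step : ∀ {m n f} → m < n → n ≤ suc f → m ≤ f
fuel-step m<n n≤1+f = ≤-pred (<-≤-trans m<n n≤1+f)

exhausted : ∀ {m n} → m < n → ¬ (n ≤ 0)
exhausted m<n n≤0 = n≮0 (<-≤-trans m<n n≤0)

gameFuel-suc : ∀ f p → weight p ≤ f → gameFuel (suc f) p ≈G gameFuel f p
gameFuel-suc zero p p≤0 = ≈G-byOptions
  (gameFuel-leftOptions 0 p {≈LeftOption (gameFuel 0 p)} (λ move → ⊥-elim (unmovable (leftMove-decreasing move))) ,
   gameFuel-rightOptions 0 p {≈RightOption (gameFuel 0 p)} (λ move → ⊥-elim (unmovable (rightMove-decreasing move))))
  ((λ ()) , (λ ()))
  where
  unmovable : ∀ {m} → ¬ (m < weight p)
  unmovable m<p = exhausted m<p p≤0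
gameFuel-suc (suc f) p p≤ = ≈G-byOptions
  (gameFuel-leftOptions (suc f) p {≈LeftOption (gameFuel (suc f) p)} (λ move →
     _ , gameFuel-leftOption⁺ f move , gameFuel-suc f _ (fuel-step (leftMove-decreasing move) p≤)) ,
   gameFuel-rightOptions (suc f) p {≈RightOption (gameFuel (suc f) p)} (λ move →
     _ , gameFuel-rightOption⁺ f move , gameFuel-suc f _ (fuel-step (rightMove-decreasing move) p≤)))
  (gameFuel-leftOptions f p {≈LeftOption (gameFuel (suc (suc f)) p)} (λ move →
     _ , gameFuel-leftOption⁺ (suc f) move , ≈G-sym (gameFuel-suc f _ (fuel-step (leftMove-decreasing move) p≤))) ,
   gameFuel-rightOptions f p {≈RightOption (gameFuel (suc (suc f)) p)} (λ move →
     _ , gameFuel-rightOption⁺ (suc f) move , ≈G-sym (gameFuel-suc f _ (fuel-step (rightMove-decreasing move) p≤))))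

mutual
  gameFuel-isNumber : ∀ f p → weight p ≤ f → IsNumber (gameFuel f p)
  gameFuel-isNumber zero p _ = (λ ()) , (λ ()) , λ ()
  gameFuel-isNumber (suc f) p p≤ = isNumber-intro
    (gameFuel-leftOptions f p {IsNumber} λ move → gameFuel-isNumber f _ (fuel-step (leftMove-decreasing move) p≤))
    (gameFuel-rightOptions f p {IsNumber} λ move → gameFuel-isNumber f _ (fuel-step (rightMove-decreasing move) p≤))
    λ {_} {z} oL oR → gameFuel-leftOptions f p {λ w → ¬ (z ≤G w)}
      (λ {A} mA → gameFuel-rightOptions f p {λ z → ¬ (z ≤G gameFuel f A)} (rightMove≰leftMove f p≤ mA) oR) oL

  exchanged-≰ : ∀ f {A B} → weight A ≤ f → weight B ≤ f →
                LeftMove B A ⊎ (∃ λ C → RightMove A C × LeftMove B C) → ¬ (gameFuel f B ≤G gameFuel f A)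
  exchanged-≰ zero A≤0 B≤0 (inj₁ B→A) _ = exhausted (leftMove-decreasing B→A) B≤0
  exchanged-≰ zero A≤0 B≤0 (inj₂ (_ , A→C , _)) _ = exhausted (rightMove-decreasing A→C) A≤0
  exchanged-≰ (suc f) {A} A≤ B≤ (inj₁ B→A) B≤A =
    leftOption-≱ (gameFuel-leftOption⁺ f B→A)
                 (≤G-trans B≤A (proj₁ (gameFuel-suc f A (fuel-step (leftMove-decreasing B→A) B≤))))
  exchanged-≰ (suc f) {A} A≤ B≤ (inj₂ (_ , A→C , B→C)) B≤A =
    leftOption-≱ (gameFuel-leftOption⁺ f B→C)
                 (≤G-trans B≤A (≤G-rightOption (gameFuel-isNumber (suc f) A A≤) (gameFuel-rightOption⁺ f A→C)))

  rightMove≰leftMove : ∀ f {p A B} → weight p ≤ suc f → LeftMove p A → RightMove p B →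
                       ¬ (gameFuel f B ≤G gameFuel f A)
  rightMove≰leftMove f p≤ mA mB =
    exchanged-≰ f (fuel-step (leftMove-decreasing mA) p≤) (fuel-step (rightMove-decreasing mB) p≤) (exchange mA mB)

theorem3p2 : (p : Position) → IsPosition p →
    ∃₂ λ (m : ℤ) (k : ℕ) → game p ≈G dyadic m k
theorem3p2 p _ = number⇒dyadic (gameFuel-isNumber (weight p) p ≤-refl)
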